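{- There is a constant $c$ such that for every satisfiable $\mathfrak{L}(\mathsf{Kh})$ formula $\varphi$ there exists an LTS $\mathfrak{M}=\langle S,(R_a)_{a\in\mathsf{Act}},V\rangle$ with $[\![\varphi]\!]^{\mathfrak{M}}\neq\emptyset$ and $|S|\le c\cdot|\varphi|^3$, i.e. $|S|\in\mathcal{O}(|\varphi|^3)$, where $|\varphi|$ is the size of $\varphi$.
   Context: Fix countable sets $\mathsf{Prop}$ of propositional symbols and $\mathsf{Act}$ of action symbols. Formulas of $\mathfrak{L}(\mathsf{Kh})$: $\varphi ::= p \mid \neg\varphi \mid \varphi\lor\varphi \mid \mathsf{Kh}(\varphi,\varphi)$, $p\in\mathsf{Prop}$. An LTS is $\mathfrak{M}=\langle S,(R_a)_{a\in\mathsf{Act}},V\rangle$ with $S\neq\emptyset$, $R_a\subseteq S\times S$, $V:\mathsf{Prop}\to 2^S$. For $\pi\in\mathsf{Act}^*$: $R_\varepsilon=\{(s,s):s\in S\}$, $R_{\pi a}$ is the composition of $R_\pi$ followed by $R_a$, $R_\pi(X)=\{t:\exists s\in X,(s,t)\in R_\pi\}$. A plan $a_1\dots a_n$ is strongly executable at $s$ iff for all $0\le i<n$ and all $t\in R_{a_1\dots a_i}(s)$, $R_{a_{i+1}}(t)\ne\emptyset$; $\mathrm{SE}(\pi)$ is the set of such states. Truth sets: $[\![p]\!]=V(p)$, $[\![\neg\varphi]\!]=S\setminus[\![\varphi]\!]$, $[\![\varphi\lor\psi]\!]=[\![\varphi]\!]\cup[\![\psi]\!]$, and $[\![\mathsf{Kh}(\varphi,\psi)]\!]=S$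 if some $\pi\in\mathsf{Act}^*$ satisfies $[\![\varphi]\!]\subseteq\mathrm{SE}(\pi)$ and $R_\pi([\![\varphi]\!])\subseteq[\![\psi]\!]$, else $\emptyset$. A formula is satisfiable iff some LTS gives it a non-empty truth set. -}

module Defs where

open import Data.Nat using (ℕ; suc; _+_)
open import Data.List using (List; []; _∷_; length; lookup; take)
open import Data.Fin using (Fin; toℕ)
open import Data.Product using (Σ; _×_; ∃)
open import Relation.Binary.PropositionalEquality using (_≡_)
open import Relation.Nullary using (¬_)

Prop : Set
Prop = ℕ

Act : Set
Act = ℕ

data Form : Set where
  var : Prop → Form
  neg : Form → Form
  _∨_ : Form → Form → Form
  Kh  : Form → Form → Form

size : Form → ℕ
size (var p)   = 1
size (neg φ)   = suc (size φ)
size (φ ∨ ψ)   = suc (size φ + size ψ)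
size (Kh φ ψ)  = suc (size φ + size ψ)

record LTS (S : Set) : Set₁ where
  field
    inhabitant : S
    R : Act → S → S → Set
    V : Prop → S → Set

Plan : Set
Plan = List Act

module _ {S : Set} (M : LTS S) where
  open LTS M

  Rπ : Plan → S → S → Set
  Rπ []      s t = s ≡ t
  Rπ (a ∷ π) s t = ∃ λ u → R a s u × Rπ π u t

  -- strong executability of a₁…aₙ at s:
  -- for all 0 ≤ i < n and all t ∈ R_{a₁…aᵢ}(s), R_{a_{i+1}}(t) ≠ ∅
  SE : Plan → S → Set
  SE π s = (i : Fin (length π)) (t : S) →
           Rπ (take (toℕ i) π) s t → ∃ λ u → R (lookup π i) t u

  ⟦_⟧ : Form → S → Set
  ⟦ var p ⟧  s = V p s
  ⟦ neg φ ⟧  s = ¬ ⟦ φ ⟧ s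
  ⟦ φ ∨ ψ ⟧  s = Data.Sum._⊎_ (⟦ φ ⟧ s) (⟦ ψ ⟧ s)
    where import Data.Sum
  ⟦ Kh φ ψ ⟧ s = Σ Plan λ π →
                   ((x : S) → ⟦ φ ⟧ x → SE π x) ×
                   ((x y : S) → ⟦ φ ⟧ x → Rπ π x y → ⟦ ψ ⟧ y)

Satisfiable : Form → Set₁
Satisfiable φ = Σ Set λ S → Σ (LTS S) λ M → ∃ λ s → ⟦_⟧ M φ s

{-# OPTIONS --safe #-}
-- Filtration through the subformulas of φ.  Using excluded middle, choose for every
-- pair (ψ, χ) of subformulas a state satisfying ψ but not χ (failing that, one
-- satisfying ψ); these |φ|² states, with the inherited valuation, decide every
-- inclusion between truth sets of subformulas.  The action naming a subformula
-- Kh(α, β) that holds leads from every α-state to every β-state.  As Kh is global,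
-- this single step realises Kh(α, β); conversely, a strongly executable plan of the
-- small model is a chain of true Kh-subformulas, and these compose in the old model.
module Submission where

open import Defs
open import Level using (0ℓ)
open import Axiom.ExcludedMiddle using (ExcludedMiddle)
open import Data.Nat using (ℕ; _≤_; _+_; _*_; _^_; suc; z≤n)
open import Data.Nat.Properties using (*-monoʳ-≤; m≤m*n; *-identityˡ; module ≤-Reasoning)
open import Data.Fin using (Fin; toℕ; combine; remQuot; zero; suc)
open import Data.Fin.Properties using (toℕ-injective; remQuot-combine)
open import Data.Product using (Σ; _×_; ∃; _,_; proj₁; proj₂; uncurry)
open import Data.Sum using (inj₁; inj₂)
open import Data.Sum.Function.Propositional using (_⊎-⇔_)
open import Data.List using (List; []; _∷_; _++_; length; lookup)
open import Data.List.Properties using (length-++)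
open import Data.List.Membership.Propositional using (_∈_)
open import Data.List.Membership.Propositional.Properties using (∈-++⁻; ∈-++⁺ˡ; ∈-++⁺ʳ)
open import Data.List.Membership.Setoid.Properties using (index-injective)
open import Data.List.Relation.Unary.Any using (here; there; index)
open import Data.List.Relation.Unary.Any.Properties using (lookup-index)
open import Data.Empty using (⊥-elim)
open import Function using (_∘_; id; _⇔_; mk⇔; Equivalence)
open import Function.Construct.Identity using (⇔-id)
open import Function.Related.TypeIsomorphisms using (¬-cong-⇔)
open import Relation.Nullary using (¬_; Dec; yes; no)
open import Relation.Unary using (Pred; _⊆_)
open import Relation.Binary.PropositionalEquality

open Equivalence using (to; from)

mutual
  subs : Form → List Form
  subs φ = φ ∷ properSubs φ

  properSubs : Form → List Form
  properSubs (var p)  = []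
  properSubs (neg φ)  = subs φ
  properSubs (φ ∨ ψ)  = subs φ ++ subs ψ
  properSubs (Kh φ ψ) = subs φ ++ subs ψ

length-subs : ∀ φ → length (subs φ) ≡ size φ
length-subs (var p)  = refl
length-subs (neg φ)  = cong suc (length-subs φ)
length-subs (φ ∨ ψ)  =
  cong suc (trans (length-++ (subs φ)) (cong₂ _+_ (length-subs φ) (length-subs ψ)))
length-subs (Kh φ ψ) =
  cong suc (trans (length-++ (subs φ)) (cong₂ _+_ (length-subs φ) (length-subs ψ)))

SubformulaClosed : List Form → Set
SubformulaClosed Γ = ∀ {ψ χ} → ψ ∈ subs χ → χ ∈ Γ → ψ ∈ Γ

mutual
  subs-closed : ∀ φ → SubformulaClosed (subs φ)
  subs-closed φ        ψ∈ (here refl) = ψ∈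
  subs-closed (neg φ)  ψ∈ (there χ∈)  = there (subs-closed φ ψ∈ χ∈)
  subs-closed (φ ∨ ψ)  ψ∈ (there χ∈)  = there (subs-++-closed φ ψ ψ∈ χ∈)
  subs-closed (Kh φ ψ) ψ∈ (there χ∈)  = there (subs-++-closed φ ψ ψ∈ χ∈)

  subs-++-closed : ∀ φ ψ → SubformulaClosed (subs φ ++ subs ψ)
  subs-++-closed φ ψ ξ∈ χ∈ with ∈-++⁻ (subs φ) χ∈
  ... | inj₁ χ∈φ = ∈-++⁺ˡ (subs-closed φ ξ∈ χ∈φ)
  ... | inj₂ χ∈ψ = ∈-++⁺ʳ (subs φ) (subs-closed ψ ξ∈ χ∈ψ)

∈-subs-++ˡ : ∀ φ ψ → φ ∈ subs φ ++ subs ψ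
∈-subs-++ˡ φ ψ = ∈-++⁺ˡ {ys = subs ψ} (here refl)

∈-subs-++ʳ : ∀ φ ψ → ψ ∈ subs φ ++ subs ψ
∈-subs-++ʳ φ ψ = ∈-++⁺ʳ (subs φ) {subs ψ} (here refl)

module _ {S : Set} (M : LTS S) where
  open LTS M

  SE-[] : ∀ {x} → SE M [] x
  SE-[] ()

  SE-∷ : ∀ {a π x} → ∃ (R a x) → (∀ {y} → R a x y → SE M π y) → SE M (a ∷ π) x
  SE-∷ (y , xy) _   zero    _ refl          = y , xy
  SE-∷ _        seπ (suc i) z (y , xy , yz) = seπ xy i z yz

  SE-head : ∀ {a π x} → SE M (a ∷ π) x → ∃ (R a x)
  SE-head se = se zero _ refl

  SE-tail : ∀ {a π x y} → SE M (a ∷ π) x → R a x y → SE M π y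
  SE-tail se xy i z yz = se (suc i) z (_ , xy , yz)

  SE⇒Rπ : ∀ π {x} → SE M π x → ∃ (Rπ M π x)
  SE⇒Rπ []      {x} _  = x , refl
  SE⇒Rπ (a ∷ π)     se =
    let y , xy = SE-head se
        z , yz = SE⇒Rπ π (SE-tail se xy)
    in  z , y , xy , yz

  SE-++ : ∀ π {π′ x} → SE M π x → (∀ {y} → Rπ M π x y → SE M π′ y) → SE M (π ++ π′) x
  SE-++ []      _  seπ′ = seπ′ refl
  SE-++ (a ∷ π) se seπ′ =
    SE-∷ (SE-head se) λ xy → SE-++ π (SE-tail se xy) λ yz → seπ′ (_ , xy , yz)

  Rπ-++⁻ : ∀ π {π′ x z} → Rπ M (π ++ π′) x z → ∃ λ y → Rπ M π x y × Rπ M π′ y z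
  Rπ-++⁻ []      xz            = _ , refl , xz
  Rπ-++⁻ (a ∷ π) (y , xy , yz) =
    let w , yw , wz = Rπ-++⁻ π yz in w , (y , xy , yw) , wz

  Achieves : Plan → Pred S 0ℓ → Pred S 0ℓ → Set
  Achieves π P Q = (∀ x → P x → SE M π x) × (∀ x y → P x → Rπ M π x y → Q y)

  KnowHow : Pred S 0ℓ → Pred S 0ℓ → Set
  KnowHow P Q = Σ Plan λ π → Achieves π P Q

  achieves-mono : ∀ {π P P′ Q Q′} → P′ ⊆ P → Q ⊆ Q′ → Achieves π P Q → Achieves π P′ Q′
  achieves-mono P′⊆P Q⊆Q′ (se , reach) =
    (λ x → se x ∘ P′⊆P) , (λ x y P′x xy → Q⊆Q′ (reach x y (P′⊆P P′x) xy))

  knowHow-mono : ∀ {P P′ Q Q′} → P′ ⊆ P → Q ⊆ Q′ → KnowHow P Q → KnowHow P′ Q′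
  knowHow-mono P′⊆P Q⊆Q′ (π , h) = π , achieves-mono P′⊆P Q⊆Q′ h

  knowHow-⊆ : ∀ {P Q} → P ⊆ Q → KnowHow P Q
  knowHow-⊆ P⊆Q = [] , (λ _ _ → SE-[]) , λ { x _ Px refl → P⊆Q Px }

  knowHow-step : ∀ {a P Q} → (∀ x → P x → ∃ (R a x)) → (∀ x y → P x → R a x y → Q y) →
                 KnowHow P Q
  knowHow-step {a} enabled reach =
    (a ∷ []) , (λ x Px → SE-∷ (enabled x Px) λ _ → SE-[]) ,
    λ { x y Px (_ , xy , refl) → reach x y Px xy }

  knowHow-trans : ∀ {P Q T} → KnowHow P Q → KnowHow Q T → KnowHow P T
  knowHow-trans (π , se , reach) (π′ , se′ , reach′) =
    (π ++ π′) ,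
    (λ x Px → SE-++ π (se x Px) λ xy → se′ _ (reach x _ Px xy)) ,
    λ x z Px xz → let y , xy , yz = Rπ-++⁻ π xz in reach′ y z (reach x y Px xy) yz

  knowHow-inhabited : ∀ {P Q x} → KnowHow P Q → P x → ∃ Q
  knowHow-inhabited (π , se , reach) Px =
    let y , xy = SE⇒Rπ π (se _ Px) in y , reach _ y Px xy

module _ {S : Set} where

  witnessOr : {B : Pred S 0ℓ} → Dec (∃ B) → S → S
  witnessOr (yes (x , _)) _ = x
  witnessOr (no _)        s = s

  witnessOr-sound : ∀ {B : Pred S 0ℓ} (d : Dec (∃ B)) {s} → ∃ B → B (witnessOr d s)
  witnessOr-sound (yes (_ , Bx)) _ = Bx
  witnessOr-sound (no ∄B)        e = ⊥-elim (∄B e)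

  witnessOr-preserves : ∀ {B C : Pred S 0ℓ} (d : Dec (∃ B)) {s} → B ⊆ C → C s → C (witnessOr d s)
  witnessOr-preserves (yes (_ , Bx)) B⊆C _  = B⊆C Bx
  witnessOr-preserves (no _)         _   Cs = Cs

module Sampling (lem : ExcludedMiddle 0ℓ) {S : Set} (default : S)
                {A : Set} (Γ : List A) (P : A → Pred S 0ℓ) where

  separable? : ∀ a b → Dec (∃ λ x → P a x × ¬ P b x)
  separable? a b = lem

  inhabited? : ∀ a → Dec (∃ (P a))
  inhabited? a = lem

  witness : A → A → S
  witness a b = witnessOr (separable? a b) (witnessOr (inhabited? a) default)

  witness-separates : ∀ {a b x} → P a x → ¬ P b x → P a (witness a b) × ¬ P b (witness a b)
  witness-separates {a} {b} Pax ¬Pbx = witnessOr-sound (separable? a b) (_ , Pax , ¬Pbx)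

  witness-∈ : ∀ {a b x} → P a x → P a (witness a b)
  witness-∈ {a} {b} Pax =
    witnessOr-preserves (separable? a b) proj₁ (witnessOr-sound (inhabited? a) (_ , Pax))

  point : Fin (length Γ * length Γ) → S
  point t = let i , j = remQuot (length Γ) t in witness (lookup Γ i) (lookup Γ j)

  point-covers : ∀ {a b} → a ∈ Γ → b ∈ Γ → {Q : Pred S 0ℓ} → Q (witness a b) → ∃ (Q ∘ point)
  point-covers {a} {b} a∈ b∈ {Q} Qw = combine i j , subst Q (sym point-combine) Qw
    where
      i = index a∈
      j = index b∈
      point-combine : point (combine i j) ≡ witness a b
      point-combine = begin
        point (combine i j)                 ≡⟨ cong (uncurry λ i j → witness (lookup Γ i) (lookup Γ j))
                                                    (remQuot-combine i j) ⟩
        witness (lookup Γ i) (lookup Γ j)   ≡⟨ cong₂ witness (sym (lookup-index a∈)) (sym (lookup-index b∈)) ⟩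
        witness a b                         ∎
        where open ≡-Reasoning

  point-hits : ∀ {a x} → a ∈ Γ → P a x → ∃ (P a ∘ point)
  point-hits {a} a∈ Pax = point-covers a∈ a∈ {P a} (witness-∈ Pax)

  point-reflects-⊆ : ∀ {a b} → a ∈ Γ → b ∈ Γ → (∀ t → P a (point t) → P b (point t)) → P a ⊆ P b
  point-reflects-⊆ {a} {b} a∈ b∈ sampled {x} Pax with lem {P b x}
  ... | yes Pbx = Pbx
  ... | no ¬Pbx =
    let t , Pat , ¬Pbt = point-covers a∈ b∈ {λ y → P a y × ¬ P b y} (witness-separates Pax ¬Pbx)
    in  ⊥-elim (¬Pbt (sampled t Pat))

module Filtration (lem : ExcludedMiddle 0ℓ) {S : Set} (M : LTS S)
                  (Γ : List Form) (closed : SubformulaClosed Γ) where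

  ⟦_⟧ᴹ : Form → Pred S 0ℓ
  ⟦_⟧ᴹ = ⟦_⟧ M

  open Sampling lem (LTS.inhabitant M) Γ ⟦_⟧ᴹ public

  -- Action toℕ i is the name of the i-th formula of Γ; it has transitions only when
  -- that formula is a true Kh(α, β).
  data Step (a : Act) (t u : Fin (length Γ * length Γ)) : Set where
    step : ∀ {α β} (p : Kh α β ∈ Γ) → toℕ (index p) ≡ a → KnowHow M ⟦ α ⟧ᴹ ⟦ β ⟧ᴹ →
           ⟦ α ⟧ᴹ (point t) → ⟦ β ⟧ᴹ (point u) → Step a t u

  step-endpoints : ∀ {α β a t u} (p : Kh α β ∈ Γ) → toℕ (index p) ≡ a → Step a t u →
                   ⟦ α ⟧ᴹ (point t) × ⟦ β ⟧ᴹ (point u)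
  step-endpoints p p↦a (step q q↦a _ αt βu)
    with index-injective (setoid Form) p q (toℕ-injective (trans p↦a (sym q↦a)))
  ... | refl = αt , βu

  module _ (t₀ : Fin (length Γ * length Γ)) where

    filtration : LTS (Fin (length Γ * length Γ))
    filtration = record { inhabitant = t₀ ; R = Step ; V = λ p → LTS.V M p ∘ point }

    ⟦_⟧ᴺ : Form → Pred (Fin (length Γ * length Γ)) 0ℓ
    ⟦_⟧ᴺ = ⟦_⟧ filtration

    knowHow-lift : ∀ {α β} → Kh α β ∈ Γ → KnowHow M ⟦ α ⟧ᴹ ⟦ β ⟧ᴹ →
                   KnowHow filtration (⟦ α ⟧ᴹ ∘ point) (⟦ β ⟧ᴹ ∘ point)
    knowHow-lift {α} {β} p kh with lem {∃ (⟦ α ⟧ᴹ ∘ point)}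
    ... | no ∄α = knowHow-⊆ filtration λ αt → ⊥-elim (∄α (_ , αt))
    ... | yes (_ , αt) =
      let _ , βx = knowHow-inhabited M kh αt
          u , βu = point-hits (closed (there (∈-subs-++ʳ α β)) p) βx
      in  knowHow-step filtration (λ _ αs → u , step p refl kh αs βu)
                                  (λ _ _ _ sv → proj₂ (step-endpoints p refl sv))

    knowHow-reflect : ∀ σ {α β} → α ∈ Γ → β ∈ Γ →
                      Achieves filtration σ (⟦ α ⟧ᴹ ∘ point) (⟦ β ⟧ᴹ ∘ point) →
                      KnowHow M ⟦ α ⟧ᴹ ⟦ β ⟧ᴹ
    knowHow-reflect [] α∈ β∈ (_ , reach) =
      knowHow-⊆ M (point-reflects-⊆ α∈ β∈ λ t αt → reach t t αt refl)
    knowHow-reflect (a ∷ σ) {α} {β} α∈ β∈ (se , reach) with lem {∃ (⟦ α ⟧ᴹ ∘ point)}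
    ... | no ∄α = knowHow-⊆ M λ αx → ⊥-elim (∄α (point-hits α∈ αx))
    ... | yes (t₁ , αt₁) with SE-head filtration (se t₁ αt₁)
    -- Every sampled α-state must take the same first step, named after a true
    -- Kh(α′, β′); so α ⊆ α′, and every sampled β′-state is a successor of t₁.
    ... | _ , step {α′} {β′} p p↦a kh α′t₁ _ =
      knowHow-trans M (knowHow-mono M α⊆α′ id kh) (knowHow-reflect σ β′∈ β∈ (se′ , reach′))
      where
        α′∈ = closed (there (∈-subs-++ˡ α′ β′)) p
        β′∈ = closed (there (∈-subs-++ʳ α′ β′)) p

        α⊆α′ : ⟦ α ⟧ᴹ ⊆ ⟦ α′ ⟧ᴹ
        α⊆α′ = point-reflects-⊆ α∈ α′∈ λ t αt →
          proj₁ (step-endpoints p p↦a (proj₂ (SE-head filtration (se t αt))))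

        edge : ∀ {u} → ⟦ β′ ⟧ᴹ (point u) → Step a t₁ u
        edge = step p p↦a kh α′t₁

        se′ : ∀ u → ⟦ β′ ⟧ᴹ (point u) → SE filtration σ u
        se′ _ β′u = SE-tail filtration (se t₁ αt₁) (edge β′u)

        reach′ : ∀ u v → ⟦ β′ ⟧ᴹ (point u) → Rπ filtration σ u v → ⟦ β ⟧ᴹ (point v)
        reach′ u v β′u uv = reach t₁ v αt₁ (u , edge β′u , uv)

    truth : ∀ ψ → ψ ∈ Γ → ∀ t → ⟦ ψ ⟧ᴺ t ⇔ ⟦ ψ ⟧ᴹ (point t)
    truth (var _)  _ _ = ⇔-id _
    truth (neg ψ)  p t = ¬-cong-⇔ (truth ψ (closed (there (here refl)) p) t)
    truth (ψ ∨ χ)  p t = truth ψ (closed (there (∈-subs-++ˡ ψ χ)) p) t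
                     ⊎-⇔ truth χ (closed (there (∈-subs-++ʳ ψ χ)) p) t
    truth (Kh ψ χ) p _ = mk⇔
      (λ (σ , h) → knowHow-reflect σ ψ∈ χ∈
                     (achieves-mono filtration (from (truth ψ ψ∈ _)) (to (truth χ χ∈ _)) h))
      (knowHow-mono filtration (to (truth ψ ψ∈ _)) (from (truth χ χ∈ _)) ∘ knowHow-lift p)
      where
        ψ∈ = closed (there (∈-subs-++ˡ ψ χ)) p
        χ∈ = closed (there (∈-subs-++ʳ ψ χ)) p

square≤cube : ∀ n → n * n ≤ n ^ 3
square≤cube 0         = z≤n
square≤cube n@(suc _) = *-monoʳ-≤ n (m≤m*n n (n * 1))

|subs|²≤|φ|³ : ∀ φ → length (subs φ) * length (subs φ) ≤ 1 * size φ ^ 3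
|subs|²≤|φ|³ φ = begin
  length (subs φ) * length (subs φ)   ≡⟨ cong (λ m → m * m) (length-subs φ) ⟩
  size φ * size φ                     ≤⟨ square≤cube (size φ) ⟩
  size φ ^ 3                          ≡⟨ *-identityˡ (size φ ^ 3) ⟨
  1 * size φ ^ 3                      ∎
  where open ≤-Reasoning

corollary2 : ExcludedMiddle 0ℓ →
    Σ ℕ λ c → (φ : Form) → Satisfiable φ →
      Σ ℕ λ n → n ≤ c * size φ ^ 3 ×
        Σ (LTS (Fin n)) λ M → ∃ λ s → ⟦_⟧ M φ s
corollary2 lem = 1 , small-model
  where
    small-model : (φ : Form) → Satisfiable φ →
                  Σ ℕ λ n → n ≤ 1 * size φ ^ 3 × Σ (LTS (Fin n)) λ M → ∃ λ s → ⟦_⟧ M φ s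
    small-model φ (_ , M , _ , φs) =
      let t , φt = point-hits (here refl) φs
      in  _ , |subs|²≤|φ|³ φ , filtration t , t , from (truth t φ (here refl) t) φt
      where open Filtration lem M (subs φ) (subs-closed φ)
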